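{- Let $M$ be a one-counter machine, with step relation $\longrightarrow_{M}$ on configurations. Then: (1) (Totality) For every configuration $(i,c)$ there is a configuration $(i',c')$ with $(i,c)\longrightarrow_{M}(i',c')$. (2) (Determinism) If $(i,c)\longrightarrow_{M}(i',c')$ and $(i,c)\longrightarrow_{M}(i'',c'')$, then $(i',c')=(i'',c'')$. (3) (Halting property) A configuration $(i,c)$ is halting if and only if $(i,c)\longrightarrow_{M}(i,c)$. (4) (Increasing measure) If $(i,c)\longrightarrow_{M}(i',c')$ and $(i,c)$ is not halting, then $|M|\cdot c+i<|M|\cdot c'+i'$. (5) (Monotone counter) (a) If $(i,c)\longrightarrow_{M}(i',c')$, then $c\le c'$. (b) If $(i,c)\longrightarrow_{M}^{|M|+1}(i',c')$ and $(i',c')$ is not halting, then $c<c'$.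
   Context: A one-counter machine $M$ is a finite list of instructions, each of shape $(j,d)$ with $j\in\mathbb{N}$ (a program index) and $d\in\{1,2,3,4\}$ (a counter modifier); instructions are indexed starting from $0$, and $|M|$ denotes the length of the list. A configuration of $M$ is a pair $(i,c)$ with $i\in\mathbb{N}$ (program index) and $c\in\mathbb{N}$, $c>0$ (counter value). The step relation $\longrightarrow_{M}$ is defined by: if $|M|\le i$ then $(i,c)\longrightarrow_{M}(i,c)$ and $(i,c)$ is called halting; if the instruction at index $i$ is $(j,d)$ and $d$ divides $c$, then $(i,c)\longrightarrow_{M}(j,c\cdot\frac{d+1}{d})$; if the instruction at index $i$ is $(j,d)$ and $d$ does not divide $c$, then $(i,c)\longrightarrow_{M}(i+1,c)$. The $n$-fold composition of the step relation is written $\longrightarrow_{M}^{n}$. -}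

module Defs where

open import Data.Nat using (ℕ; zero; suc; _+_; _*_; _≤_; _<_; NonZero)
open import Data.Nat.DivMod using (_/_)
open import Data.Nat.Divisibility using (_∣_)
open import Data.List using (List; length; lookup)
open import Data.Fin using (Fin; toℕ; fromℕ<)
open import Relation.Binary.PropositionalEquality using (_≡_)
open import Data.Product using (_×_; _,_)
open import Relation.Nullary using (¬_)

data Mod : Set where
  d1 d2 d3 d4 : Mod

val : Mod → ℕ
val d1 = 1
val d2 = 2
val d3 = 3
val d4 = 4

instance
  val-nonZero : ∀ {d} → NonZero (val d)
  val-nonZero {d1} = _
  val-nonZero {d2} = _
  val-nonZero {d3} = _
  val-nonZero {d4} = _

Instr : Set
Instr = ℕ × Mod

-- a one-counter machine: list of instructions indexed from 0
Machine : Set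
Machine = List Instr

-- configuration (i , c); the condition c > 0 is imposed where configurations are quantified
Config : Set
Config = ℕ × ℕ

-- c · (d+1)/d  (used only when d ∣ c)
scale : Mod → ℕ → ℕ
scale d c = (c / val d) * (val d + 1)

data Step (M : Machine) : Config → Config → Set where
  halt : ∀ {i c} → length M ≤ i → Step M (i , c) (i , c)
  jump : ∀ {i c j d} (i<M : i < length M) → lookup M (fromℕ< i<M) ≡ (j , d) →
         val d ∣ c → Step M (i , c) (j , scale d c)
  next : ∀ {i c j d} (i<M : i < length M) → lookup M (fromℕ< i<M) ≡ (j , d) →
         ¬ (val d ∣ c) → Step M (i , c) (suc i , c)

Halting : Machine → Config → Set
Halting M (i , c) = length M ≤ i

data Steps (M : Machine) : ℕ → Config → Config → Set where
  zero : ∀ {x} → Steps M 0 x x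
  suc  : ∀ {n x y z} → Step M x y → Steps M n y z → Steps M (suc n) x z

{-# OPTIONS --safe #-}
module Submission where

open import Defs
open import Data.Nat using (ℕ; zero; suc; _+_; _*_; _≤_; _<_; _≤?_; _<?_; z≤n; s≤s)
open import Data.Nat.Properties
open import Data.Nat.DivMod using (_/_; m*n/n≡m)
open import Data.Nat.Divisibility using (_∣_; divides; _∣?_)
open import Data.List using (length; lookup)
open import Data.Fin using (fromℕ<)
open import Data.Product using (_×_; _,_; ∃₂)
open import Data.Sum using (_⊎_; inj₁; inj₂)
open import Data.Empty using (⊥-elim)
open import Relation.Binary.PropositionalEquality
open import Relation.Nullary using (¬_; yes; no)
open import Function.Bundles using (_⇔_; mk⇔)

-- A jump multiplies c = q·d by (d+1)/d, i.e. adds q; positivity of c makes q positive.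
-- A step therefore never decreases the counter, and a non-halting step raises the rank
-- |M|·c + i: a jump adds at least |M| (more than the index can lose), a fall-through adds 1.
-- Within |M| + 1 steps without a jump the index would run past the end of the program.

scale-multiple : ∀ d q → scale d (q * val d) ≡ q * val d + q
scale-multiple d q = begin
  (q * val d / val d) * (val d + 1)  ≡⟨ cong (_* (val d + 1)) (m*n/n≡m q (val d)) ⟩
  q * (val d + 1)                    ≡⟨ *-distribˡ-+ q (val d) 1 ⟩
  q * val d + q * 1                  ≡⟨ cong (q * val d +_) (*-identityʳ q) ⟩
  q * val d + q                      ∎
  where open ≡-Reasoning

≤-scale : ∀ d {c} → val d ∣ c → c ≤ scale d c
≤-scale d (divides q refl) = subst (q * val d ≤_) (sym (scale-multiple d q)) (m≤m+n _ q)

<-scale : ∀ d {c} → val d ∣ c → 0 < c → c < scale d c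
<-scale d (divides zero refl) ()
<-scale d (divides (suc q) refl) _ =
  subst (suc q * val d <_) (sym (scale-multiple d (suc q))) (m<m+n _ (s≤s z≤n))

instruction-unique : ∀ (M : Machine) {i j j′ d d′} (p q : i < length M) →
  lookup M (fromℕ< p) ≡ (j , d) → lookup M (fromℕ< q) ≡ (j′ , d′) → j ≡ j′ × d ≡ d′
instruction-unique M p q e e′ rewrite ≤-irrelevant p q with trans (sym e) e′
... | refl = refl , refl

step-total : ∀ (M : Machine) i c → ∃₂ λ i′ c′ → Step M (i , c) (i′ , c′)
step-total M i c with i <? length M
... | no i≮M = i , c , halt (≮⇒≥ i≮M)
... | yes i<M with lookup M (fromℕ< i<M) in e
... | j , d with val d ∣? c
... | yes d∣c = j , scale d c , jump i<M e d∣c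
... | no d∤c = suc i , c , next i<M e d∤c

step-deterministic : ∀ {M : Machine} {x y z} → Step M x y → Step M x z → y ≡ z
step-deterministic (halt _)     (halt _)     = refl
step-deterministic (halt h)     (jump p _ _) = ⊥-elim (<⇒≱ p h)
step-deterministic (halt h)     (next p _ _) = ⊥-elim (<⇒≱ p h)
step-deterministic (jump p _ _) (halt h)     = ⊥-elim (<⇒≱ p h)
step-deterministic (next p _ _) (halt h)     = ⊥-elim (<⇒≱ p h)
step-deterministic {M} (jump p e _) (jump q e′ _) with instruction-unique M p q e e′
... | refl , refl = refl
step-deterministic {M} (jump p e d∣c) (next q e′ d∤c) with instruction-unique M p q e e′
... | refl , refl = ⊥-elim (d∤c d∣c)
step-deterministic {M} (next p e d∤c) (jump q e′ d∣c) with instruction-unique M p q e e′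
... | refl , refl = ⊥-elim (d∤c d∣c)
step-deterministic (next _ _ _) (next _ _ _) = refl

step-counter-mono : ∀ {M : Machine} {i c i′ c′} → Step M (i , c) (i′ , c′) → c ≤ c′
step-counter-mono (halt _)               = ≤-refl
step-counter-mono (jump {d = d} _ _ d∣c) = ≤-scale d d∣c
step-counter-mono (next _ _ _)           = ≤-refl

step-rank-increasing : ∀ {M : Machine} {i c i′ c′} → 0 < c → Step M (i , c) (i′ , c′) →
  ¬ Halting M (i , c) → length M * c + i < length M * c′ + i′
step-rank-increasing _ (halt h) ¬h = ⊥-elim (¬h h)
step-rank-increasing {M} {i} {c} {j} 0<c (jump {d = d} i<M _ d∣c) _ = begin-strict
  length M * c + i          <⟨ +-monoʳ-< (length M * c) i<M ⟩
  length M * c + length M   ≡⟨ +-comm (length M * c) (length M) ⟩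
  length M + length M * c   ≡⟨ *-suc (length M) c ⟨
  length M * suc c          ≤⟨ *-monoʳ-≤ (length M) (<-scale d d∣c 0<c) ⟩
  length M * scale d c      ≤⟨ m≤m+n _ j ⟩
  length M * scale d c + j  ∎
  where open ≤-Reasoning
step-rank-increasing {M} {i} {c} _ (next _ _ _) _ = ≤-reflexive (sym (+-suc (length M * c) i))

halting⇔self-step : ∀ (M : Machine) i c → 0 < c → Halting M (i , c) ⇔ Step M (i , c) (i , c)
halting⇔self-step M i c 0<c = mk⇔ halt self-step⇒halting
  where
  self-step⇒halting : Step M (i , c) (i , c) → Halting M (i , c)
  self-step⇒halting s with length M ≤? i
  ... | yes h = h
  ... | no ¬h = ⊥-elim (<-irrefl refl (step-rank-increasing 0<c s ¬h))

steps-from-halting : ∀ {M : Machine} {n i c y} → Halting M (i , c) → Steps M n (i , c) y → y ≡ (i , c)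
steps-from-halting h zero                  = refl
steps-from-halting h (suc (halt _) s)      = steps-from-halting h s
steps-from-halting h (suc (jump p _ _) _)  = ⊥-elim (<⇒≱ p h)
steps-from-halting h (suc (next p _ _) _)  = ⊥-elim (<⇒≱ p h)

steps-counter-grows-or-index-advances : ∀ {M : Machine} {n i c i′ c′} → 0 < c →
  Steps M n (i , c) (i′ , c′) → ¬ Halting M (i′ , c′) → c < c′ ⊎ (c ≡ c′ × i′ ≡ i + n)
steps-counter-grows-or-index-advances {i = i} _ zero _ = inj₂ (refl , sym (+-identityʳ i))
steps-counter-grows-or-index-advances _ (suc (halt h) s) ¬h′ with steps-from-halting h s
... | refl = ⊥-elim (¬h′ h)
steps-counter-grows-or-index-advances 0<c (suc (jump {d = d} _ _ d∣c) s) ¬h′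
  with <-scale d d∣c 0<c
... | c<c₁ with steps-counter-grows-or-index-advances (<-trans 0<c c<c₁) s ¬h′
...   | inj₁ c₁<c′       = inj₁ (<-trans c<c₁ c₁<c′)
...   | inj₂ (refl , _)  = inj₁ c<c₁
steps-counter-grows-or-index-advances {n = suc n} {i} 0<c (suc (next _ _ _) s) ¬h′
  with steps-counter-grows-or-index-advances 0<c s ¬h′
... | inj₁ c<c′           = inj₁ c<c′
... | inj₂ (refl , i′≡)   = inj₂ (refl , trans i′≡ (sym (+-suc i n)))

lemma3p4 : (M : Machine) →
    ((i c : ℕ) → 0 < c → ∃₂ λ i′ c′ → 0 < c′ × Step M (i , c) (i′ , c′))
    × ((i c i′ c′ i″ c″ : ℕ) → 0 < c → Step M (i , c) (i′ , c′) → Step M (i , c) (i″ , c″) → (i′ , c′) ≡ (i″ , c″))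
    × ((i c : ℕ) → 0 < c → (Halting M (i , c) ⇔ Step M (i , c) (i , c)))
    × ((i c i′ c′ : ℕ) → 0 < c → Step M (i , c) (i′ , c′) → ¬ Halting M (i , c) → length M * c + i < length M * c′ + i′)
    × ((i c i′ c′ : ℕ) → 0 < c → Step M (i , c) (i′ , c′) → c ≤ c′)
    × ((i c i′ c′ : ℕ) → 0 < c → Steps M (suc (length M)) (i , c) (i′ , c′) → ¬ Halting M (i′ , c′) → c < c′)
lemma3p4 M =
    total
  , (λ _ _ _ _ _ _ _ → step-deterministic)
  , halting⇔self-step M
  , (λ _ _ _ _ → step-rank-increasing)
  , (λ _ _ _ _ _ → step-counter-mono)
  , after-|M|+1-steps
  where
  total : (i c : ℕ) → 0 < c → ∃₂ λ i′ c′ → 0 < c′ × Step M (i , c) (i′ , c′)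
  total i c 0<c with step-total M i c
  ... | i′ , c′ , s = i′ , c′ , <-≤-trans 0<c (step-counter-mono s) , s

  after-|M|+1-steps : (i c i′ c′ : ℕ) → 0 < c → Steps M (suc (length M)) (i , c) (i′ , c′) →
    ¬ Halting M (i′ , c′) → c < c′
  after-|M|+1-steps i c i′ c′ 0<c s ¬h′ with steps-counter-grows-or-index-advances 0<c s ¬h′
  ... | inj₁ c<c′         = c<c′
  ... | inj₂ (_ , refl)   = ⊥-elim (¬h′ (≤-trans (n≤1+n (length M)) (m≤n+m _ i)))
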